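{- There is an absolute constant $c>0$ such that for every $\Delta\ge 2$ the following holds: any online edge-coloring algorithm in the advice-with-request model that receives $b$ advice bits per edge and produces an optimal edge coloring (using $\chi'(G)$ colors) for every bipartite input graph $G$ of maximum degree $\Delta$ must satisfy $b\ge c\log \Delta$. That is, optimal online edge coloring in the advice-with-request model requires $\Omega(\log\Delta)$ bits of advice per edge, even for bipartite graphs.
   Context: All graphs are simple; $\Delta$ denotes maximum degree and $\chi'(G)$ the chromatic index (minimum number of colors in a proper edge coloring, where adjacent edges get distinct colors). Online edge coloring: the edges of an unknown graph arrive one at a time, specified by their endpoints; each must be irrevocably colored before the next arrives, keeping the coloring proper. Advice-with-request model: with each edge $e_i$ the algorithm receives a bit string $b_i\in\{0,1\}^b$ (for a fixed $b$) from an oracle that knows the entire input; the color of $e_i$ may depend only on $e_1,\dots,e_i$ and $b_1,\dots,b_i$. -}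

module Defs where

open import Data.Nat using (ℕ; _≤_; _<_; _≟_)
open import Data.Bool using (Bool)
open import Data.Product using (_×_; _,_; ∃-syntax; Σ-syntax; proj₁; proj₂)
open import Data.Sum using (_⊎_)
open import Data.List using (List; []; _∷_; _++_; [_]; length; zip; filter; deduplicate)
open import Data.List.Relation.Unary.All using (All)
open import Data.List.Relation.Unary.AllPairs using (AllPairs)
open import Data.Vec using (Vec)
open import Relation.Binary.PropositionalEquality using (_≡_; _≢_)
open import Relation.Nullary using (¬_; Dec)
open import Relation.Nullary.Decidable using (_⊎-dec_)

Edge : Set
Edge = ℕ × ℕ

-- A graph (together with an arrival order) is a list of edges.
Graph : Set
Graph = List Edge

SameEdge : Edge → Edge → Set
SameEdge (u , v) (x , y) = (u ≡ x × v ≡ y) ⊎ (u ≡ y × v ≡ x)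

Simple : Graph → Set
Simple es = All (λ { (u , v) → u ≢ v }) es × AllPairs (λ e f → ¬ SameEdge e f) es

incident? : (w : ℕ) → (e : Edge) → Dec (w ≡ proj₁ e ⊎ w ≡ proj₂ e)
incident? w (u , v) = (w ≟ u) ⊎-dec (w ≟ v)

deg : ℕ → Graph → ℕ
deg w es = length (filter (incident? w) es)

MaxDegree : Graph → ℕ → Set
MaxDegree es Δ = (∀ w → deg w es ≤ Δ) × ∃[ w ] (deg w es ≡ Δ)

Bipartite : Graph → Set
Bipartite es = Σ[ side ∈ (ℕ → Bool) ] All (λ { (u , v) → side u ≢ side v }) es

Adjacent : Edge → Edge → Set
Adjacent (u , v) (x , y) = u ≡ x ⊎ u ≡ y ⊎ v ≡ x ⊎ v ≡ y

-- cs is a proper edge colouring of es (colour of the i-th edge = i-th entry)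
ProperColoring : Graph → List ℕ → Set
ProperColoring es cs =
  length cs ≡ length es ×
  AllPairs (λ { (e , c) (f , d) → Adjacent e f → c ≢ d }) (zip es cs)

Colorable : Graph → ℕ → Set
Colorable es k = ∃[ cs ] (ProperColoring es cs × All (_< k) cs)

ChromaticIndex : Graph → ℕ → Set
ChromaticIndex es k = Colorable es k × (∀ j → Colorable es j → k ≤ j)

numColors : List ℕ → ℕ
numColors cs = length (deduplicate _≟_ cs)

Optimal : Graph → List ℕ → Set
Optimal es cs = ProperColoring es cs × (∀ k → ChromaticIndex es k → numColors cs ≡ k)

Advice : ℕ → Set
Advice b = Vec Bool b

-- deterministic online algorithm with advice-with-request: the colour of e_i
-- is a function of (e_1,…,e_i) and (b_1,…,b_i)
OnlineAlg : ℕ → Set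
OnlineAlg b = List Edge → List (Advice b) → ℕ

runFrom : ∀ {b} → OnlineAlg b → List Edge → List (Advice b) →
          List Edge → List (Advice b) → List ℕ
runFrom A hE hA (e ∷ es) (a ∷ as) =
  A (hE ++ [ e ]) (hA ++ [ a ]) ∷ runFrom A (hE ++ [ e ]) (hA ++ [ a ]) es as
runFrom A hE hA _ _ = []

run : ∀ {b} → OnlineAlg b → Graph → List (Advice b) → List ℕ
run A es as = runFrom A [] [] es as

-- A, with a suitable oracle, colours every bipartite simple graph of maximum
-- degree Δ optimally, for every arrival order of its edges
SolvesBipartite : ∀ {b} → ℕ → OnlineAlg b → Set
SolvesBipartite {b} Δ A =
  (es : Graph) → Simple es → Bipartite es → MaxDegree es Δ →
  ∃[ as ] (length as ≡ length es × Optimal es (run A es as))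

-- For every f : Fin Δ → Fin Δ there is a bipartite graph G_f of maximum degree Δ and chromatic
-- index Δ whose first 2Δ edges, a star of Δ spokes and Δ disjoint test edges, do not depend on f.
-- The rest of G_f consists of Δ copies of K_{Δ,Δ} minus an edge, chained so that in every
-- optimal colouring test edge i gets the colour of spoke f i, while the spokes get distinct
-- colours. An online algorithm colours the first 2Δ edges knowing only them and their advice, so
-- the advice for those edges determines f: Δ^Δ ≤ 2^(2Δb), whence ⌊log₂ Δ⌋ ≤ 2b.

module Submission where

open import Defs
open import Data.Nat using (ℕ; _≤_; _*_)
open import Data.Nat.Logarithm using (⌊log₂_⌋)
open import Data.Product using (∃-syntax)

import Data.Nat.Properties as ℕP
open import Algebra.Properties.CommutativeSemigroup ℕP.+-commutativeSemigroup using (xy∙z≈xz∙y)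
open import Data.Bool using (Bool; true; false; not)
open import Data.Empty using (⊥-elim)
open import Data.Fin as F using (Fin; toℕ; fromℕ<; finToFun; funToFin)
import Data.Fin.Induction as FI
import Data.Fin.Properties as FP
open import Data.List as L using (List; []; _∷_; _++_; length; map; zip; filter; take)
import Data.List.Properties as LP
open import Data.List.Membership.Propositional using (_∈_)
import Data.List.Membership.Propositional.Properties as ∈P
open import Data.List.Relation.Binary.Disjoint.Propositional using (Disjoint)
open import Data.List.Relation.Unary.All as All using (All; []; _∷_)
import Data.List.Relation.Unary.All.Properties as AllP
open import Data.List.Relation.Unary.AllPairs as AllPairs using (AllPairs; []; _∷_)
import Data.List.Relation.Unary.AllPairs.Properties as AllPairsP
open import Data.List.Relation.Unary.Any as Any using (here; there)
import Data.List.Relation.Unary.Any.Properties as AnyP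
open import Data.List.Relation.Unary.Unique.Propositional using (Unique)
import Data.List.Relation.Unary.Unique.Propositional.Properties as UP
open import Data.Maybe using (Maybe; just; nothing)
open import Data.Nat as ℕ using (zero; suc; _+_; _<_; _∸_; _^_; _%_; z≤n; s≤s; NonZero)
open import Data.Nat.DivMod using (m<n⇒m%n≡m; m≤n⇒[n∸m]%m≡n%m; %-distribˡ-+; m%n<n)
open import Data.Nat.Logarithm using (⌊log₂⌋-mono-≤; ⌊log₂[2^n]⌋≡n)
open import Data.Product as Product using (Σ; _×_; _,_; proj₁; proj₂; ∃)
import Data.Product.Properties as Prod
open import Data.Sum using (_⊎_; inj₁; inj₂)
open import Data.Sum.Function.Propositional using (_⊎-↔_)
import Data.Sum.Properties as Sum
open import Data.Vec as V using (Vec)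
import Data.Vec.Properties as VP
open import Data.Vec.Relation.Binary.Equality.Cast using (cast-is-id)
open import Function using (_∘_; id)
open import Function.Bundles using (_↣_; Injection)
open import Function.Construct.Identity using (↔-id)
open import Function.Definitions using (Injective)
open import Function.Properties.Inverse using (↔⇒↣; ↔-sym; ↔-trans)
open import Induction.WellFounded using (Acc; acc)
open import Level using (0ℓ)
open import Relation.Binary using (DecidableEquality; Rel; tri<; tri≈; tri>)
open import Relation.Binary.PropositionalEquality
  using (_≡_; _≢_; _≗_; refl; sym; trans; cong; cong₂; subst; module ≡-Reasoning)
open import Relation.Nullary using (¬_; Dec; yes; no; does)
open import Relation.Nullary.Decidable using (decidable-stable)

injective⇒surjective : ∀ {n} {g : Fin n → Fin n} → Injective _≡_ _≡_ g → ∀ y → ∃ λ x → g x ≡ y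
injective⇒surjective {suc m} {g} g-inj y with FP.any? (λ x → g x FP.≟ y)
... | yes hit = hit
... | no miss = ⊥-elim (ℕP.<-irrefl refl (FP.injective⇒≤ {f = avoid} avoid-inj))
  where
  y≢g : ∀ x → y ≢ g x
  y≢g x eq = miss (x , sym eq)
  avoid : Fin (suc m) → Fin m
  avoid x = F.punchOut (y≢g x)
  avoid-inj : Injective _≡_ _≡_ avoid
  avoid-inj {x} {z} eq = g-inj (FP.punchOut-injective (y≢g x) (y≢g z) eq)

funToFin-cong : ∀ {m n} {g h : Fin m → Fin n} → g ≗ h → funToFin g ≡ funToFin h
funToFin-cong {zero} g≗h = refl
funToFin-cong {suc m} g≗h = cong₂ F.combine (g≗h F.zero) (funToFin-cong (g≗h ∘ F.suc))

finToFun-injective : ∀ {m n} {k k' : Fin (n ^ m)} → finToFun {n} {m} k ≗ finToFun k' → k ≡ k'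
finToFun-injective {m} {n} {k} {k'} eq = begin
  k                                ≡⟨ FP.funToFin-finToFin {m} {n} k ⟨
  funToFin (finToFun {n} {m} k)    ≡⟨ funToFin-cong {m} {n} eq ⟩
  funToFin (finToFun {n} {m} k')   ≡⟨ FP.funToFin-finToFin {m} {n} k' ⟩
  k'                               ∎
  where open ≡-Reasoning

distinct⇒length≤ : ∀ {k} (xs : List ℕ) → AllPairs _≢_ xs → All (_< k) xs → length xs ≤ k
distinct⇒length≤ {k} xs xs! xs<k = FP.injective⇒≤ {f = g} g-inj
  where
  g : Fin (length xs) → Fin k
  g i = fromℕ< (All.lookup xs<k (∈P.∈-lookup i))
  lookup-inj : ∀ {ys : List ℕ} → AllPairs _≢_ ys → Injective _≡_ _≡_ (L.lookup ys)
  lookup-inj {_ ∷ _} _ {F.zero} {F.zero} _ = refl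
  lookup-inj {_ ∷ _} (h ∷ _) {F.zero} {F.suc j} eq = ⊥-elim (All.lookup h (∈P.∈-lookup j) eq)
  lookup-inj {_ ∷ _} (h ∷ _) {F.suc i} {F.zero} eq = ⊥-elim (All.lookup h (∈P.∈-lookup i) (sym eq))
  lookup-inj {_ ∷ _} (_ ∷ t) {F.suc i} {F.suc j} eq = cong F.suc (lookup-inj t eq)
  g-inj : Injective _≡_ _≡_ g
  g-inj eq = lookup-inj xs! (trans (sym (FP.toℕ-fromℕ< _)) (trans (cong toℕ eq) (FP.toℕ-fromℕ< _)))

injective-resp-≗ : ∀ {A B : Set} {g h : A → B} → g ≗ h → Injective _≡_ _≡_ h → Injective _≡_ _≡_ g
injective-resp-≗ g≗h h-inj {s} {t} eq = h-inj (trans (sym (g≗h s)) (trans eq (g≗h t)))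

module LastBelow {D : ℕ} {P : Fin D → Set} (P? : ∀ k → Dec (P k)) where

  lastBelow : (m : ℕ) → m ≤ D → Maybe (Fin D)
  lastBelow zero    _   = nothing
  lastBelow (suc m) m<D with P? (fromℕ< m<D)
  ... | yes _ = just (fromℕ< m<D)
  ... | no  _ = lastBelow m (ℕP.<⇒≤ m<D)

  private
    toℕ≡m⇒P : ∀ {m} (m<D : m < D) {k} → toℕ k ≡ m → P k → P (fromℕ< m<D)
    toℕ≡m⇒P m<D k≡m = subst P (FP.toℕ-injective (trans k≡m (sym (FP.toℕ-fromℕ< m<D))))

  lastBelow-just : ∀ m m≤D {k} → lastBelow m m≤D ≡ just k → P k × toℕ k < m
  lastBelow-just (suc m) m<D eq with P? (fromℕ< m<D)
  lastBelow-just (suc m) m<D refl | yes Pk = Pk , subst (_< suc m) (sym (FP.toℕ-fromℕ< m<D)) (ℕP.n<1+n m)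
  ... | no _ = Product.map₂ ℕP.m<n⇒m<1+n (lastBelow-just m _ eq)

  lastBelow-nothing : ∀ m m≤D → lastBelow m m≤D ≡ nothing → ∀ k → toℕ k < m → ¬ P k
  lastBelow-nothing (suc m) m<D eq k k<m with P? (fromℕ< m<D)
  lastBelow-nothing (suc m) m<D () k k<m | yes _
  ... | no ¬P with toℕ k ℕP.≟ m
  ...   | yes k≡m = ¬P ∘ toℕ≡m⇒P m<D k≡m
  ...   | no  k≢m = lastBelow-nothing m _ eq k (ℕP.≤∧≢⇒< (ℕP.≤-pred k<m) k≢m)

  lastBelow-last : ∀ m m≤D {k} → lastBelow m m≤D ≡ just k → ∀ k' → toℕ k < toℕ k' → toℕ k' < m → ¬ P k'
  lastBelow-last (suc m) m<D eq k' k<k' k'<m with P? (fromℕ< m<D)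
  lastBelow-last (suc m) m<D refl k' k<k' k'<m | yes _ =
    ⊥-elim (ℕP.<⇒≱ k<k' (subst (toℕ k' ≤_) (sym (FP.toℕ-fromℕ< m<D)) (ℕP.≤-pred k'<m)))
  ... | no ¬P with toℕ k' ℕP.≟ m
  ...   | yes k'≡m = ¬P ∘ toℕ≡m⇒P m<D k'≡m
  ...   | no  k'≢m = lastBelow-last m _ eq k' k<k' (ℕP.≤∧≢⇒< (ℕP.≤-pred k'<m) k'≢m)

_⊎ˡ_ : ∀ {A B : Set} → List A → List B → List (A ⊎ B)
xs ⊎ˡ ys = map inj₁ xs ++ map inj₂ ys

⊎ˡ-unique : ∀ {A B : Set} {xs : List A} {ys : List B} → Unique xs → Unique ys → Unique (xs ⊎ˡ ys)
⊎ˡ-unique xs! ys! = UP.++⁺ (UP.map⁺ Sum.inj₁-injective xs!) (UP.map⁺ Sum.inj₂-injective ys!) apart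
  where
  apart : Disjoint _ _
  apart (u∈ , v∈) with ∈P.∈-map⁻ inj₁ u∈ | ∈P.∈-map⁻ inj₂ v∈
  ... | _ , _ , refl | _ , _ , ()

∈-⊎ˡ⁺ˡ : ∀ {A B : Set} {u : A} {xs} (ys : List B) → u ∈ xs → inj₁ u ∈ xs ⊎ˡ ys
∈-⊎ˡ⁺ˡ ys u∈ = ∈P.∈-++⁺ˡ (∈P.∈-map⁺ inj₁ u∈)

∈-⊎ˡ⁺ʳ : ∀ {A B : Set} {v : B} (xs : List A) {ys} → v ∈ ys → inj₂ v ∈ xs ⊎ˡ ys
∈-⊎ˡ⁺ʳ xs v∈ = ∈P.∈-++⁺ʳ (map inj₁ xs) (∈P.∈-map⁺ inj₂ v∈)

⊎ˡ-complete : ∀ {A B : Set} {xs : List A} {ys : List B} →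
  (∀ u → u ∈ xs) → (∀ v → v ∈ ys) → ∀ w → w ∈ xs ⊎ˡ ys
⊎ˡ-complete {ys = ys} xs-all ys-all (inj₁ u) = ∈-⊎ˡ⁺ˡ ys (xs-all u)
⊎ˡ-complete {xs = xs} xs-all ys-all (inj₂ v) = ∈-⊎ˡ⁺ʳ xs (ys-all v)

cartesianProduct-complete : ∀ {A B : Set} {xs : List A} {ys : List B} →
  (∀ u → u ∈ xs) → (∀ v → v ∈ ys) → ∀ w → w ∈ L.cartesianProduct xs ys
cartesianProduct-complete xs-all ys-all (u , v) = ∈P.∈-cartesianProduct⁺ (xs-all u) (ys-all v)

length-⊎ˡ : ∀ {A B : Set} (xs : List A) (ys : List B) → length (xs ⊎ˡ ys) ≡ length xs + length ys
length-⊎ˡ xs ys = trans (LP.length-++ (map inj₁ xs)) (cong₂ _+_ (LP.length-map inj₁ xs) (LP.length-map inj₂ ys))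

[u+d]%n≡u⇒d≡0 : ∀ n {u d} → u < suc n → d < suc n → (u + d) % suc n ≡ u → d ≡ 0
[u+d]%n≡u⇒d≡0 n {u} {d} u<n d<n eq with u + d ℕP.<? suc n
... | yes u+d<n = ℕP.+-cancelˡ-≡ u d 0 (trans (trans (sym (m<n⇒m%n≡m u+d<n)) eq) (sym (ℕP.+-identityʳ u)))
... | no u+d≮n = ⊥-elim (ℕP.<-irrefl (sym (ℕP.+-cancelˡ-≡ u _ _ wrapped)) d<n)
  where
  n≤u+d : suc n ≤ u + d
  n≤u+d = ℕP.≮⇒≥ u+d≮n
  u+d∸n≡u : u + d ∸ suc n ≡ u
  u+d∸n≡u = trans (sym (m<n⇒m%n≡m (ℕP.m<n+o⇒m∸n<o (u + d) (suc n) (ℕP.+-mono-< u<n d<n))))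
                  (trans (m≤n⇒[n∸m]%m≡n%m n≤u+d) eq)
  wrapped : u + suc n ≡ u + d
  wrapped = trans (cong (_+ suc n) (sym u+d∸n≡u)) (ℕP.m∸n+n≡m n≤u+d)

+-%-cancelˡ-≤ : ∀ n a {x y} → x ≤ y → y < suc n → (a + x) % suc n ≡ (a + y) % suc n → x ≡ y
+-%-cancelˡ-≤ n a {x} {y} x≤y y<n eq = begin
  x             ≡⟨ ℕP.+-identityʳ x ⟨
  x + 0         ≡⟨ cong (x +_) ([u+d]%n≡u⇒d≡0 n (m%n<n (a + x) (suc n)) d<n shift) ⟨
  x + (y ∸ x)   ≡⟨ ℕP.m+[n∸m]≡n x≤y ⟩
  y             ∎
  where
  open ≡-Reasoning
  d<n : y ∸ x < suc n
  d<n = ℕP.≤-<-trans (ℕP.m∸n≤m y x) y<n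
  shift : ((a + x) % suc n + (y ∸ x)) % suc n ≡ (a + x) % suc n
  shift = begin
    ((a + x) % suc n + (y ∸ x)) % suc n             ≡⟨ cong (λ z → ((a + x) % suc n + z) % suc n) (m<n⇒m%n≡m d<n) ⟨
    ((a + x) % suc n + (y ∸ x) % suc n) % suc n     ≡⟨ %-distribˡ-+ (a + x) (y ∸ x) (suc n) ⟨
    (a + x + (y ∸ x)) % suc n                       ≡⟨ cong (_% suc n) (ℕP.+-assoc a x (y ∸ x)) ⟩
    (a + (x + (y ∸ x))) % suc n                     ≡⟨ cong (λ z → (a + z) % suc n) (ℕP.m+[n∸m]≡n x≤y) ⟩
    (a + y) % suc n                                 ≡⟨ eq ⟨
    (a + x) % suc n                                 ∎

+-%-cancelˡ : ∀ n a {x y} → x < suc n → y < suc n → (a + x) % suc n ≡ (a + y) % suc n → x ≡ y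
+-%-cancelˡ n a {x} {y} x<n y<n eq with ℕP.≤-total x y
... | inj₁ x≤y = +-%-cancelˡ-≤ n a x≤y y<n eq
... | inj₂ y≤x = sym (+-%-cancelˡ-≤ n a y≤x x<n (sym eq))

⌊log₂⌋-bound : ∀ Δ b → Δ ^ Δ ≤ (2 ^ b) ^ (2 * Δ) → ⌊log₂ Δ ⌋ ≤ 2 * b
⌊log₂⌋-bound Δ b Δ^Δ≤ = begin
  ⌊log₂ Δ ⌋             ≤⟨ ⌊log₂⌋-mono-≤ Δ≤2^2b ⟩
  ⌊log₂ (2 ^ (2 * b)) ⌋ ≡⟨ ⌊log₂[2^n]⌋≡n (2 * b) ⟩
  2 * b                 ∎
  where
  open ℕP.≤-Reasoning
  regroup : (2 ^ b) ^ (2 * Δ) ≡ (2 ^ (2 * b)) ^ Δ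
  regroup = begin-equality
    (2 ^ b) ^ (2 * Δ)   ≡⟨ ℕP.^-*-assoc 2 b (2 * Δ) ⟩
    2 ^ (b * (2 * Δ))   ≡⟨ cong (2 ^_) (ℕP.*-assoc b 2 Δ) ⟨
    2 ^ (b * 2 * Δ)     ≡⟨ cong (λ e → 2 ^ (e * Δ)) (ℕP.*-comm b 2) ⟩
    2 ^ (2 * b * Δ)     ≡⟨ ℕP.^-*-assoc 2 (2 * b) Δ ⟨
    (2 ^ (2 * b)) ^ Δ   ∎
  Δ≤2^2b : Δ ≤ 2 ^ (2 * b)
  Δ≤2^2b with Δ ℕP.≤? 2 ^ (2 * b)
  ... | yes Δ≤ = Δ≤
  ... | no Δ≰ = ⊥-elim (ℕP.<⇒≱ (ℕP.^-monoˡ-< Δ {{nonZero}} big) (subst (Δ ^ Δ ≤_) regroup Δ^Δ≤))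
    where
    big : 2 ^ (2 * b) < Δ
    big = ℕP.≰⇒> Δ≰
    nonZero : NonZero Δ
    nonZero = ℕ.>-nonZero (ℕP.≤-<-trans z≤n big)

-- Forcing in a punctured square

-- Row 0 reads the pendant colour p in place of the missing corner, column 0 reads q.
module PuncturedSquare {n : ℕ} (M : Fin (suc n) → Fin (suc n) → Fin (suc n)) (p q : Fin (suc n)) where

  row : Fin (suc n) → Fin (suc n) → Fin (suc n)
  row F.zero    F.zero    = p
  row F.zero    (F.suc s) = M F.zero (F.suc s)
  row (F.suc r) s         = M (F.suc r) s

  column : Fin (suc n) → Fin (suc n) → Fin (suc n)
  column F.zero    F.zero    = q
  column F.zero    (F.suc r) = M (F.suc r) F.zero
  column (F.suc s) r         = M r (F.suc s)

  -- Every column s ≥ 1 meets p, and not in row 0 (whose p is the pendant), so the rows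
  -- carrying these p's form a permutation of 1…n; hence no p is left for column 0
  -- except the pendant q.
  module _ (row-injective : ∀ r → Injective _≡_ _≡_ (row r))
           (column-injective : ∀ s → Injective _≡_ _≡_ (column s)) where

    rowOfP : (s : Fin n) → Σ (Fin n) λ r → M (F.suc r) (F.suc s) ≡ p
    rowOfP s with injective⇒surjective (column-injective (F.suc s)) p
    ... | F.zero  , eq with () ← row-injective F.zero {F.suc s} {F.zero} eq
    ... | F.suc r , eq = r , eq

    rowOfP-injective : Injective _≡_ _≡_ (proj₁ ∘ rowOfP)
    rowOfP-injective {s} {t} eq with rowOfP s | rowOfP t
    ... | r , es | r' , et with refl ← eq =
      FP.suc-injective (row-injective (F.suc r) (trans es (sym et)))

    pendants-agree : p ≡ q
    pendants-agree with injective⇒surjective (column-injective F.zero) p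
    ... | F.zero  , eq = sym eq
    ... | F.suc r , eq with injective⇒surjective rowOfP-injective r
    ... | s , refl with rowOfP s
    ... | r , es with () ← row-injective (F.suc r) {F.zero} {F.suc s} (trans eq (sym es))

ProperPair : Edge × ℕ → Edge × ℕ → Set
ProperPair (e , c) (f , d) = Adjacent e f → c ≢ d

coloursAt : ℕ → List (Edge × ℕ) → List ℕ
coloursAt w = map proj₂ ∘ filter (incident? w ∘ proj₁)

AllPairs-restrict : ∀ {A : Set} {P : A → Set} {R : Rel A 0ℓ} {xs} →
  All P xs → AllPairs (λ x y → P x → P y → R x y) xs → AllPairs R xs
AllPairs-restrict [] [] = []
AllPairs-restrict (px ∷ pxs) (h ∷ t) =
  All.zipWith (λ (r , py) → r px py) (h , pxs) ∷ AllPairs-restrict pxs t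

incident⇒adjacent : ∀ {w} e f → (w ≡ proj₁ e ⊎ w ≡ proj₂ e) → (w ≡ proj₁ f ⊎ w ≡ proj₂ f) → Adjacent e f
incident⇒adjacent e f (inj₁ a) (inj₁ b) = inj₁ (trans (sym a) b)
incident⇒adjacent e f (inj₁ a) (inj₂ b) = inj₂ (inj₁ (trans (sym a) b))
incident⇒adjacent e f (inj₂ a) (inj₁ b) = inj₂ (inj₂ (inj₁ (trans (sym a) b)))
incident⇒adjacent e f (inj₂ a) (inj₂ b) = inj₂ (inj₂ (inj₂ (trans (sym a) b)))

coloursAt-distinct : ∀ w {es cs} → ProperColoring es cs → AllPairs _≢_ (coloursAt w (zip es cs))
coloursAt-distinct w {es} {cs} (_ , proper) =
  AllPairsP.map⁺ (AllPairs-restrict (AllP.all-filter (incident? w ∘ proj₁) (zip es cs))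
    (AllPairsP.filter⁺ (incident? w ∘ proj₁)
      (AllPairs.map (λ {(e , _)} {(f , _)} c≢d iₑ i_f → c≢d (incident⇒adjacent e f iₑ i_f)) proper)))

length-coloursAt : ∀ w (es : Graph) (cs : List ℕ) → length cs ≡ length es →
                   length (coloursAt w (zip es cs)) ≡ deg w es
length-coloursAt w [] [] _ = refl
length-coloursAt w (e ∷ es) (c ∷ cs) eq with does (incident? w e)
... | true  = cong suc (length-coloursAt w es cs (ℕP.suc-injective eq))
... | false = length-coloursAt w es cs (ℕP.suc-injective eq)

map-proj₂-zip : ∀ {A B : Set} (xs : List A) (ys : List B) → length ys ≡ length xs → map proj₂ (zip xs ys) ≡ ys
map-proj₂-zip [] [] _ = refl
map-proj₂-zip (x ∷ xs) (y ∷ ys) eq = cong (y ∷_) (map-proj₂-zip xs ys (ℕP.suc-injective eq))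

deg-++ˡ : ∀ w xs ys → deg w xs ≤ deg w (xs ++ ys)
deg-++ˡ w xs ys = begin
  length (filter (incident? w) xs)                                 ≤⟨ ℕP.m≤m+n _ _ ⟩
  length (filter (incident? w) xs) + length (filter (incident? w) ys) ≡⟨ LP.length-++ (filter (incident? w) xs) ⟨
  length (filter (incident? w) xs ++ filter (incident? w) ys)       ≡⟨ cong length (LP.filter-++ (incident? w) xs ys) ⟨
  length (filter (incident? w) (xs ++ ys))                         ∎
  where open ℕP.≤-Reasoning

proper⇒deg≤ : ∀ {k} es {cs} → ProperColoring es cs → All (_< k) cs → ∀ w → deg w es ≤ k
proper⇒deg≤ {k} es {cs} pc cs<k w =
  subst (_≤ k) (length-coloursAt w es cs (proj₁ pc))
    (distinct⇒length≤ _ (coloursAt-distinct w pc)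
      (AllP.map⁺ (AllP.filter⁺ (incident? w ∘ proj₁)
        (AllP.map⁻ (subst (All (_< k)) (sym (map-proj₂-zip es cs (proj₁ pc))) cs<k)))))

adjacent-sym : ∀ e f → Adjacent e f → Adjacent f e
adjacent-sym e f (inj₁ x)                 = inj₁ (sym x)
adjacent-sym e f (inj₂ (inj₁ x))          = inj₂ (inj₂ (inj₁ (sym x)))
adjacent-sym e f (inj₂ (inj₂ (inj₁ x)))   = inj₂ (inj₁ (sym x))
adjacent-sym e f (inj₂ (inj₂ (inj₂ x)))   = inj₂ (inj₂ (inj₂ (sym x)))

-- colourOf xs cs κ is the colour that cs gives to the edge named κ in the edge list map E xs
-- (0 if κ ∉ xs).
module NamedEdges {K : Set} (_≟K_ : DecidableEquality K) where

  colourOf : List K → List ℕ → K → ℕ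
  colourOf []       _        κ = 0
  colourOf (x ∷ xs) []       κ = 0
  colourOf (x ∷ xs) (c ∷ cs) κ with κ ≟K x
  ... | yes _ = c
  ... | no  _ = colourOf xs cs κ

  colourOf-++ˡ : ∀ {κ} P Q cs → κ ∈ P → colourOf (P ++ Q) cs κ ≡ colourOf P (take (length P) cs) κ
  colourOf-++ˡ     (x ∷ P) Q []       κ∈ = refl
  colourOf-++ˡ {κ} (x ∷ P) Q (c ∷ cs) κ∈ with κ ≟K x
  ... | yes _   = refl
  ... | no κ≢x  = colourOf-++ˡ P Q cs (Any.tail κ≢x κ∈)

  module _ (E : K → Edge) where

    colourOf-∈-zip : ∀ {κ} xs cs → κ ∈ xs → length cs ≡ length (map E xs) →
                     (E κ , colourOf xs cs κ) ∈ zip (map E xs) cs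
    colourOf-∈-zip {κ} (x ∷ xs) (c ∷ cs) κ∈ eq with κ ≟K x
    ... | yes refl = here refl
    ... | no  κ≢x  = there (colourOf-∈-zip xs cs (Any.tail κ≢x κ∈) (ℕP.suc-injective eq))

    colourOf-∈ : ∀ {κ} xs cs → κ ∈ xs → length cs ≡ length (map E xs) → colourOf xs cs κ ∈ cs
    colourOf-∈ {κ} xs cs κ∈ eq = subst (colourOf xs cs κ ∈_) (map-proj₂-zip (map E xs) cs eq)
                                   (∈P.∈-map⁺ proj₂ (colourOf-∈-zip xs cs κ∈ eq))

    colourOf-proper : ∀ xs {cs} → ProperColoring (map E xs) cs →
      ∀ {κ κ'} → κ ∈ xs → κ' ∈ xs → κ ≢ κ' → Adjacent (E κ) (E κ') → colourOf xs cs κ ≢ colourOf xs cs κ'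
    colourOf-proper (x ∷ xs) {c ∷ cs} (eq , h ∷ t) {κ} {κ'} κ∈ κ'∈ κ≢κ' adj with κ ≟K x | κ' ≟K x
    ... | yes refl | yes refl = ⊥-elim (κ≢κ' refl)
    ... | yes refl | no κ'≢x =
      All.lookup h (colourOf-∈-zip xs cs (Any.tail κ'≢x κ'∈) (ℕP.suc-injective eq)) adj
    ... | no κ≢x   | yes refl =
      All.lookup h (colourOf-∈-zip xs cs (Any.tail κ≢x κ∈) (ℕP.suc-injective eq)) (adjacent-sym _ _ adj) ∘ sym
    ... | no κ≢x   | no κ'≢x  =
      colourOf-proper xs (ℕP.suc-injective eq , t) (Any.tail κ≢x κ∈) (Any.tail κ'≢x κ'∈) κ≢κ' adj

    map-proper : ∀ (χ : K → ℕ) xs → AllPairs _≢_ xs →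
      (∀ {κ κ'} → κ ≢ κ' → Adjacent (E κ) (E κ') → χ κ ≢ χ κ') → ProperColoring (map E xs) (map χ xs)
    map-proper χ xs xs! χ-proper = trans (LP.length-map χ xs) (sym (LP.length-map E xs)) , pairs xs xs!
      where
      pairs : ∀ xs → AllPairs _≢_ xs →
              AllPairs ProperPair (zip (map E xs) (map χ xs))
      pairs []       []         = []
      pairs (x ∷ xs) (x∉ ∷ xs!) = head xs x∉ ∷ pairs xs xs!
        where
        head : ∀ ys → All (x ≢_) ys → All (ProperPair (E x , χ x)) (zip (map E ys) (map χ ys))
        head []       []         = []
        head (y ∷ ys) (x≢y ∷ x∉) = χ-proper x≢y ∷ head ys x∉

runFrom-++-prefix : ∀ {b} (A : OnlineAlg b) hE hA (P Q : Graph) as →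
  take (length P) (runFrom A hE hA (P ++ Q) as) ≡ runFrom A hE hA P (take (length P) as)
runFrom-++-prefix A hE hA []      Q as       = refl
runFrom-++-prefix A hE hA (e ∷ P) Q []       = refl
runFrom-++-prefix A hE hA (e ∷ P) Q (a ∷ as) =
  cong (A (hE ++ L.[ e ]) (hA ++ L.[ a ]) ∷_) (runFrom-++-prefix A (hE ++ L.[ e ]) (hA ++ L.[ a ]) P Q as)

-- Shorter lists are padded with a₀, so encodeList is injective only on lists of length L.
encodeList : ∀ {A : Set} {k} → A → (A → Fin k) → ∀ L → List A → Fin (k ^ L)
encodeList a₀ enc zero    _        = F.zero
encodeList a₀ enc (suc L) []       = F.combine (enc a₀) (encodeList a₀ enc L [])
encodeList a₀ enc (suc L) (x ∷ xs) = F.combine (enc x) (encodeList a₀ enc L xs)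

encodeList-injective : ∀ {A : Set} {k} (a₀ : A) {enc : A → Fin k} → Injective _≡_ _≡_ enc →
  ∀ L {xs ys} → length xs ≡ L → length ys ≡ L → encodeList a₀ enc L xs ≡ encodeList a₀ enc L ys → xs ≡ ys
encodeList-injective a₀ enc-inj zero    {[]}     {[]}     _  _  _  = refl
encodeList-injective a₀ {enc} enc-inj (suc L) {x ∷ xs} {y ∷ ys} lx ly eq
  with FP.combine-injective (enc x) (encodeList a₀ enc L xs) (enc y) (encodeList a₀ enc L ys) eq
... | x≡y , xs≡ys = cong₂ _∷_ (enc-inj x≡y)
  (encodeList-injective a₀ enc-inj L (ℕP.suc-injective lx) (ℕP.suc-injective ly) xs≡ys)

bool↣Fin2 : Bool ↣ Fin 2
bool↣Fin2 = ↔⇒↣ (↔-sym FP.2↔Bool)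

encodeBits : ∀ {b} → Vec Bool b → Fin (2 ^ b)
encodeBits {b} v = encodeList false (Injection.to bool↣Fin2) b (V.toList v)

encodeBits-injective : ∀ {b} → Injective _≡_ _≡_ (encodeBits {b})
encodeBits-injective {b} {v} {w} eq = trans (sym (cast-is-id refl v)) (VP.toList-injective refl v w
  (encodeList-injective false (Injection.injective bool↣Fin2) b (VP.length-toList v) (VP.length-toList w) eq))

-- The lower-bound graph

-- Both sides of the bipartite graph are indexed alike: on the left a hub o, vertices xᵢ and
-- aᵢᵣ; on the right leaves ℓⱼ, vertices yᵢ and bᵢₛ (i, j < Δ = suc n and r, s < n).
Side : ℕ → Set
Side n = Fin (suc n) ⊎ Fin (suc n) ⊎ (Fin (suc n) × Fin n)

pattern hub    = inj₁ F.zero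
pattern xᵛ i   = inj₂ (inj₁ i)
pattern aᵛ i r = inj₂ (inj₂ (i , r))
pattern ℓᵛ j   = inj₁ j
pattern yᵛ i   = inj₂ (inj₁ i)
pattern bᵛ i s = inj₂ (inj₂ (i , s))

side↣Fin : ∀ {n} → Side n ↣ Fin (suc n + (suc n + suc n * n))
side↣Fin = ↔⇒↣ (↔-sym (↔-trans FP.+↔⊎ (↔-id _ ⊎-↔ ↔-trans FP.+↔⊎ (↔-id _ ⊎-↔ FP.*↔×))))

leftNumber rightNumber : ∀ {n} → Side n → ℕ
leftNumber  v = 2 * toℕ (Injection.to side↣Fin v)
rightNumber w = suc (2 * toℕ (Injection.to side↣Fin w))

leftNumber-injective : ∀ {n} → Injective _≡_ _≡_ (leftNumber {n})
leftNumber-injective eq =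
  Injection.injective side↣Fin (FP.toℕ-injective (ℕP.*-cancelˡ-≡ _ _ 2 eq))

rightNumber-injective : ∀ {n} → Injective _≡_ _≡_ (rightNumber {n})
rightNumber-injective eq =
  Injection.injective side↣Fin (FP.toℕ-injective (ℕP.*-cancelˡ-≡ _ _ 2 (ℕP.suc-injective eq)))

leftNumber≢rightNumber : ∀ {n} (v w : Side n) → leftNumber v ≢ rightNumber w
leftNumber≢rightNumber v w = ℕP.even≢odd (toℕ (Injection.to side↣Fin v)) (toℕ (Injection.to side↣Fin w))

isEven : ℕ → Bool
isEven zero    = true
isEven (suc m) = not (isEven m)

isEven-2* : ∀ m → isEven (2 * m) ≡ true
isEven-2* zero    = refl
isEven-2* (suc m) rewrite ℕP.+-suc m (m + 0) | isEven-2* m = refl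

-- Probe edges (spokes o ℓⱼ and tests xᵢ yᵢ) come first in the arrival order and do not
-- depend on the function encoded by the graph.
ProbeName InteriorName EdgeName : ℕ → Set
ProbeName    n = Fin (suc n) ⊎ Fin (suc n)
InteriorName n = (Fin (suc n) × Fin n) ⊎ (Fin (suc n) × Fin n × Fin (suc n))
EdgeName     n = ProbeName n ⊎ InteriorName n

pattern spoke j    = inj₁ (inj₁ j)
pattern test i     = inj₁ (inj₂ i)
pattern top i s    = inj₂ (inj₁ (i , s))
pattern cell i r s = inj₂ (inj₂ (i , r , s))

_≟ₑ_ : ∀ {n} → DecidableEquality (EdgeName n)
_≟ₑ_ = Sum.≡-dec (Sum.≡-dec FP._≟_ FP._≟_)
                 (Sum.≡-dec (Prod.≡-dec FP._≟_ FP._≟_) (Prod.≡-dec FP._≟_ (Prod.≡-dec FP._≟_ FP._≟_)))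

probeNames : ∀ n → List (ProbeName n)
probeNames n = L.allFin (suc n) ⊎ˡ L.allFin (suc n)

interiorNames : ∀ n → List (InteriorName n)
interiorNames n = L.cartesianProduct (L.allFin (suc n)) (L.allFin n)
               ⊎ˡ L.cartesianProduct (L.allFin (suc n)) (L.cartesianProduct (L.allFin n) (L.allFin (suc n)))

edgeNames : ∀ n → List (EdgeName n)
edgeNames n = probeNames n ⊎ˡ interiorNames n

edgeNames-unique : ∀ n → Unique (edgeNames n)
edgeNames-unique n = ⊎ˡ-unique (⊎ˡ-unique (UP.allFin⁺ _) (UP.allFin⁺ _))
  (⊎ˡ-unique (UP.cartesianProduct⁺ (UP.allFin⁺ _) (UP.allFin⁺ _))
             (UP.cartesianProduct⁺ (UP.allFin⁺ _) (UP.cartesianProduct⁺ (UP.allFin⁺ _) (UP.allFin⁺ _))))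

∈-edgeNames : ∀ {n} (κ : EdgeName n) → κ ∈ edgeNames n
∈-edgeNames = ⊎ˡ-complete (⊎ˡ-complete ∈P.∈-allFin ∈P.∈-allFin)
  (⊎ˡ-complete (cartesianProduct-complete ∈P.∈-allFin ∈P.∈-allFin)
               (cartesianProduct-complete ∈P.∈-allFin (cartesianProduct-complete ∈P.∈-allFin ∈P.∈-allFin)))

length-probeNames : ∀ n → length (probeNames n) ≡ 2 * suc n
length-probeNames n = trans (length-⊎ˡ (L.allFin (suc n)) _)
  (cong₂ _+_ length-allFin (trans length-allFin (sym (ℕP.+-identityʳ (suc n)))))
  where
  length-allFin : length (L.allFin (suc n)) ≡ suc n
  length-allFin = LP.length-tabulate {n = suc n} id

probeLeft probeRight : ∀ {n} → ProbeName n → Side n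
probeLeft  (inj₁ j) = hub
probeLeft  (inj₂ i) = xᵛ i
probeRight (inj₁ j) = ℓᵛ j
probeRight (inj₂ i) = yᵛ i

probeEdge : ∀ {n} → ProbeName n → Edge
probeEdge π = leftNumber (probeLeft π) , rightNumber (probeRight π)

probeEdges : ℕ → Graph
probeEdges n = map probeEdge (probeNames n)

-- For every i the vertices xᵢ, aᵢᵣ (rows) and anchor i, bᵢₛ (columns) span a copy of K_{Δ,Δ}
-- minus the edge xᵢ–anchor i, whose two ends are completed to degree Δ by the pendant edges
-- test i and anchorEdge i. The anchor of i is yₖ for the last k < i with f k = f i, or the
-- leaf ℓ_{f i} if there is none, so that every vertex keeps degree at most Δ.
module LowerBoundGraph (n : ℕ) (f : Fin (suc n) → Fin (suc n)) where

  D : ℕ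
  D = suc n

  previous : Fin D → Maybe (Fin D)
  previous i = lastBelow (toℕ i) (ℕP.<⇒≤ (FP.toℕ<n i))
    where open LastBelow (λ k → f k FP.≟ f i)

  previous-just : ∀ i {k} → previous i ≡ just k → f k ≡ f i × toℕ k < toℕ i
  previous-just i = LastBelow.lastBelow-just (λ k → f k FP.≟ f i) (toℕ i) _

  anchorVia : Fin D → Maybe (Fin D) → Side n
  anchorVia i nothing  = ℓᵛ (f i)
  anchorVia i (just k) = yᵛ k

  anchorProbeVia : Fin D → Maybe (Fin D) → ProbeName n
  anchorProbeVia i nothing  = inj₁ (f i)
  anchorProbeVia i (just k) = inj₂ k

  anchor : Fin D → Side n
  anchor i = anchorVia i (previous i)

  anchorEdge : Fin D → EdgeName n
  anchorEdge i = inj₁ (anchorProbeVia i (previous i))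

  anchor≡ℓᵛ : ∀ i {j} → anchor i ≡ ℓᵛ j → f i ≡ j
  anchor≡ℓᵛ i eq with previous i
  anchor≡ℓᵛ i refl | nothing = refl

  anchor≡yᵛ : ∀ i {k} → anchor i ≡ yᵛ k → f k ≡ f i
  anchor≡yᵛ i eq with previous i in eqₚ
  anchor≡yᵛ i refl | just k = proj₁ (previous-just i eqₚ)

  anchor≢bᵛ : ∀ i {i' s} → anchor i ≢ bᵛ i' s
  anchor≢bᵛ i eq with previous i
  anchor≢bᵛ i () | nothing
  anchor≢bᵛ i () | just k

  <⇒anchor≢ : ∀ {i i'} → toℕ i < toℕ i' → anchor i ≢ anchor i'
  <⇒anchor≢ {i} {i'} i<i' eq with previous i in eqₚ | previous i' in eqₚ'
  ... | nothing | nothing =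
    LastBelow.lastBelow-nothing (λ k → f k FP.≟ f i') (toℕ i') _ eqₚ' i i<i' (Sum.inj₁-injective eq)
  ... | just k  | just k' with refl ← eq | previous-just i eqₚ | previous-just i' eqₚ'
  ...   | fk≡fi , k<i | fk≡fi' , _ =
    LastBelow.lastBelow-last (λ k → f k FP.≟ f i') (toℕ i') _ eqₚ' i k<i i<i' (trans (sym fk≡fi) fk≡fi')

  anchor-injective : Injective _≡_ _≡_ anchor
  anchor-injective {i} {i'} eq with FP.<-cmp i i'
  ... | tri< i<i' _ _ = ⊥-elim (<⇒anchor≢ i<i' eq)
  ... | tri≈ _ i≡i' _ = i≡i'
  ... | tri> _ _ i>i' = ⊥-elim (<⇒anchor≢ i>i' (sym eq))

  left right : EdgeName n → Side n
  left (inj₁ π)     = probeLeft π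
  left (top i s)    = xᵛ i
  left (cell i r s) = aᵛ i r
  right (inj₁ π)            = probeRight π
  right (top i s)           = bᵛ i s
  right (cell i r F.zero)    = anchor i
  right (cell i r (F.suc s)) = bᵛ i s

  edge : EdgeName n → Edge
  edge κ = leftNumber (left κ) , rightNumber (right κ)

  right-anchorEdge : ∀ i → right (anchorEdge i) ≡ anchor i
  right-anchorEdge i with previous i
  ... | nothing = refl
  ... | just _  = refl

  adjacent⇒shared : ∀ κ κ' → Adjacent (edge κ) (edge κ') → left κ ≡ left κ' ⊎ right κ ≡ right κ'
  adjacent⇒shared κ κ' (inj₁ eq)                = inj₁ (leftNumber-injective eq)
  adjacent⇒shared κ κ' (inj₂ (inj₁ eq))         = ⊥-elim (leftNumber≢rightNumber (left κ) (right κ') eq)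
  adjacent⇒shared κ κ' (inj₂ (inj₂ (inj₁ eq)))  = ⊥-elim (leftNumber≢rightNumber (left κ') (right κ) (sym eq))
  adjacent⇒shared κ κ' (inj₂ (inj₂ (inj₂ eq)))  = inj₂ (rightNumber-injective eq)

  endpoints-injective : ∀ κ κ' → left κ ≡ left κ' → right κ ≡ right κ' → κ ≡ κ'
  endpoints-injective (spoke j)            (spoke .j)            _    refl = refl
  endpoints-injective (test i)             (test .i)             refl _    = refl
  endpoints-injective (top i s)            (top .i .s)           refl refl = refl
  endpoints-injective (cell i r F.zero)    (cell .i .r F.zero)    refl _    = refl
  endpoints-injective (cell i r F.zero)    (cell .i .r (F.suc s)) refl eq   = ⊥-elim (anchor≢bᵛ i eq)
  endpoints-injective (cell i r (F.suc s)) (cell .i .r F.zero)    refl eq   = ⊥-elim (anchor≢bᵛ i (sym eq))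
  endpoints-injective (cell i r (F.suc s)) (cell .i .r (F.suc .s)) refl refl = refl
  endpoints-injective (spoke _) (test _)     () _
  endpoints-injective (spoke _) (top _ _)    () _
  endpoints-injective (spoke _) (cell _ _ _) () _
  endpoints-injective (test _)  (spoke _)    () _
  endpoints-injective (test _)  (top _ _)    _  ()
  endpoints-injective (test _)  (cell _ _ _) () _
  endpoints-injective (top _ _) (spoke _)    () _
  endpoints-injective (top _ _) (test _)     _  ()
  endpoints-injective (top _ _) (cell _ _ _) () _
  endpoints-injective (cell _ _ _) (spoke _) () _
  endpoints-injective (cell _ _ _) (test _)  () _
  endpoints-injective (cell _ _ _) (top _ _) () _

  -- A cyclic Latin square on each gadget, shifted by f i; spoke j sits in column j of a
  -- shared row, which makes the colours meet correctly at the anchors.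
  base rowIndex columnIndex : EdgeName n → ℕ
  base (spoke j)    = 0
  base (test i)     = toℕ (f i)
  base (top i s)    = toℕ (f i)
  base (cell i r s) = toℕ (f i)
  rowIndex (cell i r s) = suc (toℕ r)
  rowIndex _            = 0
  columnIndex (spoke j)    = toℕ j
  columnIndex (test i)     = 0
  columnIndex (top i s)    = suc (toℕ s)
  columnIndex (cell i r s) = toℕ s

  colour : EdgeName n → ℕ
  colour κ = (base κ + rowIndex κ + columnIndex κ) % D

  rowIndex<D : ∀ κ → rowIndex κ < D
  rowIndex<D (inj₁ _)     = s≤s z≤n
  rowIndex<D (top _ _)    = s≤s z≤n
  rowIndex<D (cell _ r _) = s≤s (FP.toℕ<n r)

  columnIndex<D : ∀ κ → columnIndex κ < D
  columnIndex<D (spoke j)    = FP.toℕ<n j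
  columnIndex<D (test _)     = s≤s z≤n
  columnIndex<D (top _ s)    = s≤s (FP.toℕ<n s)
  columnIndex<D (cell _ _ s) = FP.toℕ<n s

  colour≢-in-row : ∀ κ κ' → base κ + rowIndex κ ≡ base κ' + rowIndex κ' →
                   columnIndex κ ≢ columnIndex κ' → colour κ ≢ colour κ'
  colour≢-in-row κ κ' same-row c≢c' eq = c≢c' (+-%-cancelˡ n (base κ + rowIndex κ)
    (columnIndex<D κ) (columnIndex<D κ') (trans eq (cong (λ z → (z + columnIndex κ') % D) (sym same-row))))

  colour≢-in-column : ∀ κ κ' → base κ + columnIndex κ ≡ base κ' + columnIndex κ' →
                      rowIndex κ ≢ rowIndex κ' → colour κ ≢ colour κ'
  colour≢-in-column κ κ' same-column r≢r' eq =
    r≢r' (+-%-cancelˡ n (base κ + columnIndex κ) (rowIndex<D κ) (rowIndex<D κ') (begin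
      (base κ + columnIndex κ + rowIndex κ) % D     ≡⟨ cong (_% D) (xy∙z≈xz∙y (base κ) _ _) ⟨
      colour κ                                      ≡⟨ eq ⟩
      colour κ'                                     ≡⟨ cong (_% D) (xy∙z≈xz∙y (base κ') _ _) ⟩
      (base κ' + columnIndex κ' + rowIndex κ') % D  ≡⟨ cong (λ z → (z + rowIndex κ') % D) same-column ⟨
      (base κ + columnIndex κ + rowIndex κ') % D    ∎))
    where open ≡-Reasoning

  shared-left⇒colour≢ : ∀ κ κ' → κ ≢ κ' → left κ ≡ left κ' → colour κ ≢ colour κ'
  shared-left⇒colour≢ (spoke j)    (spoke j')     κ≢κ' _    =
    colour≢-in-row (spoke j) (spoke j') refl (κ≢κ' ∘ cong spoke ∘ FP.toℕ-injective)
  shared-left⇒colour≢ (test i)     (test .i)      κ≢κ' refl = ⊥-elim (κ≢κ' refl)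
  shared-left⇒colour≢ (test i)     (top .i s)     _    refl = colour≢-in-row (test i) (top i s) refl λ ()
  shared-left⇒colour≢ (top i s)    (test .i)      _    refl = colour≢-in-row (top i s) (test i) refl λ ()
  shared-left⇒colour≢ (top i s)    (top .i s')    κ≢κ' refl =
    colour≢-in-row (top i s) (top i s') refl (κ≢κ' ∘ cong (top i) ∘ FP.toℕ-injective ∘ ℕP.suc-injective)
  shared-left⇒colour≢ (cell i r s) (cell .i .r s') κ≢κ' refl =
    colour≢-in-row (cell i r s) (cell i r s') refl (κ≢κ' ∘ cong (cell i r) ∘ FP.toℕ-injective)
  shared-left⇒colour≢ (spoke _)    (test _)     _ ()
  shared-left⇒colour≢ (spoke _)    (top _ _)    _ ()
  shared-left⇒colour≢ (spoke _)    (cell _ _ _) _ ()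
  shared-left⇒colour≢ (test _)     (spoke _)    _ ()
  shared-left⇒colour≢ (test _)     (cell _ _ _) _ ()
  shared-left⇒colour≢ (top _ _)    (spoke _)    _ ()
  shared-left⇒colour≢ (top _ _)    (cell _ _ _) _ ()
  shared-left⇒colour≢ (cell _ _ _) (spoke _)    _ ()
  shared-left⇒colour≢ (cell _ _ _) (test _)     _ ()
  shared-left⇒colour≢ (cell _ _ _) (top _ _)    _ ()

  shared-right⇒colour≢ : ∀ κ κ' → κ ≢ κ' → right κ ≡ right κ' → colour κ ≢ colour κ'
  shared-right⇒colour≢ (spoke j) (spoke .j) κ≢κ' refl = ⊥-elim (κ≢κ' refl)
  shared-right⇒colour≢ (test k)  (test .k)  κ≢κ' refl = ⊥-elim (κ≢κ' refl)
  shared-right⇒colour≢ (top i s) (top .i .s) κ≢κ' refl = ⊥-elim (κ≢κ' refl)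
  shared-right⇒colour≢ (spoke j) (cell i r F.zero) _ eq =
    colour≢-in-column (spoke j) (cell i r F.zero) (trans (cong toℕ (sym (anchor≡ℓᵛ i (sym eq)))) (sym (ℕP.+-identityʳ _))) λ ()
  shared-right⇒colour≢ (cell i r F.zero) (spoke j) _ eq =
    colour≢-in-column (cell i r F.zero) (spoke j) (trans (ℕP.+-identityʳ _) (cong toℕ (anchor≡ℓᵛ i eq))) λ ()
  shared-right⇒colour≢ (test k) (cell i r F.zero) _ eq =
    colour≢-in-column (test k) (cell i r F.zero) (cong (λ z → toℕ z + 0) (anchor≡yᵛ i (sym eq))) λ ()
  shared-right⇒colour≢ (cell i r F.zero) (test k) _ eq =
    colour≢-in-column (cell i r F.zero) (test k) (cong (λ z → toℕ z + 0) (sym (anchor≡yᵛ i eq))) λ ()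
  shared-right⇒colour≢ (top i s) (cell .i r (F.suc .s)) _ refl =
    colour≢-in-column (top i s) (cell i r (F.suc s)) refl λ ()
  shared-right⇒colour≢ (cell i r (F.suc s)) (top .i .s) _ refl =
    colour≢-in-column (cell i r (F.suc s)) (top i s) refl λ ()
  shared-right⇒colour≢ (cell i r F.zero) (cell i' r' F.zero) κ≢κ' eq with refl ← anchor-injective eq =
    colour≢-in-column (cell i r F.zero) (cell i r' F.zero) refl
      (κ≢κ' ∘ cong (λ z → cell i z F.zero) ∘ FP.toℕ-injective ∘ ℕP.suc-injective)
  shared-right⇒colour≢ (cell i r (F.suc s)) (cell .i r' (F.suc .s)) κ≢κ' refl =
    colour≢-in-column (cell i r (F.suc s)) (cell i r' (F.suc s)) refl
      (κ≢κ' ∘ cong (λ z → cell i z (F.suc s)) ∘ FP.toℕ-injective ∘ ℕP.suc-injective)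
  shared-right⇒colour≢ (top i _) (cell i' _ F.zero) _ eq = ⊥-elim (anchor≢bᵛ i' (sym eq))
  shared-right⇒colour≢ (cell i _ F.zero) (top i' _) _ eq = ⊥-elim (anchor≢bᵛ i eq)
  shared-right⇒colour≢ (cell i _ F.zero) (cell _ _ (F.suc _)) _ eq = ⊥-elim (anchor≢bᵛ i eq)
  shared-right⇒colour≢ (cell _ _ (F.suc _)) (cell i _ F.zero) _ eq = ⊥-elim (anchor≢bᵛ i (sym eq))
  shared-right⇒colour≢ (spoke _) (test _)  _ ()
  shared-right⇒colour≢ (spoke _) (top _ _) _ ()
  shared-right⇒colour≢ (spoke _) (cell _ _ (F.suc _)) _ ()
  shared-right⇒colour≢ (test _)  (spoke _) _ ()
  shared-right⇒colour≢ (test _)  (top _ _) _ ()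
  shared-right⇒colour≢ (test _)  (cell _ _ (F.suc _)) _ ()
  shared-right⇒colour≢ (top _ _) (spoke _) _ ()
  shared-right⇒colour≢ (top _ _) (test _)  _ ()
  shared-right⇒colour≢ (cell _ _ (F.suc _)) (spoke _) _ ()
  shared-right⇒colour≢ (cell _ _ (F.suc _)) (test _)  _ ()

  colour-proper : ∀ {κ κ'} → κ ≢ κ' → Adjacent (edge κ) (edge κ') → colour κ ≢ colour κ'
  colour-proper {κ} {κ'} κ≢κ' adj with adjacent⇒shared κ κ' adj
  ... | inj₁ same-left  = shared-left⇒colour≢ κ κ' κ≢κ' same-left
  ... | inj₂ same-right = shared-right⇒colour≢ κ κ' κ≢κ' same-right

  graph : Graph
  graph = map edge (edgeNames n)

  graph-split : graph ≡ probeEdges n ++ map edge (map inj₂ (interiorNames n))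
  graph-split = trans (LP.map-++ edge (map inj₁ (probeNames n)) _)
                      (cong (_++ map edge (map inj₂ (interiorNames n))) (sym (LP.map-∘ (probeNames n))))

  colouring : List ℕ
  colouring = map colour (edgeNames n)

  colouring-proper : ProperColoring graph colouring
  colouring-proper = map-proper edge colour (edgeNames n) (edgeNames-unique n) colour-proper
    where open NamedEdges _≟ₑ_

  colouring-bounded : All (_< D) colouring
  colouring-bounded = AllP.map⁺ (All.universal (λ κ → m%n<n (base κ + rowIndex κ + columnIndex κ) D) (edgeNames n))

  graph-simple : Simple graph
  graph-simple = AllP.map⁺ (All.universal (λ κ → leftNumber≢rightNumber (left κ) (right κ)) (edgeNames n))
               , AllPairsP.map⁺ (AllPairs.map (λ {κ} {κ'} κ≢κ' → κ≢κ' ∘ same⇒≡ κ κ') (edgeNames-unique n))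
    where
    same⇒≡ : ∀ κ κ' → SameEdge (edge κ) (edge κ') → κ ≡ κ'
    same⇒≡ κ κ' (inj₁ (l≡ , r≡)) = endpoints-injective κ κ' (leftNumber-injective l≡) (rightNumber-injective r≡)
    same⇒≡ κ κ' (inj₂ (l≡r , _)) = ⊥-elim (leftNumber≢rightNumber (left κ) (right κ') l≡r)

  graph-bipartite : Bipartite graph
  graph-bipartite = isEven , AllP.map⁺ (All.universal side≢ (edgeNames n))
    where
    side≢ : ∀ κ → isEven (leftNumber (left κ)) ≢ isEven (rightNumber (right κ))
    side≢ κ rewrite isEven-2* (toℕ (Injection.to side↣Fin (left κ)))
                  | isEven-2* (toℕ (Injection.to side↣Fin (right κ))) = λ ()

  deg-hub : deg (leftNumber {n} hub) graph ≡ D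
  deg-hub = ℕP.≤-antisym (proper⇒deg≤ graph colouring-proper colouring-bounded o) (begin
    D                                     ≡⟨ LP.length-tabulate {n = D} id ⟨
    length (L.allFin D)                   ≡⟨ LP.length-map (probeEdge ∘ inj₁) (L.allFin D) ⟨
    length spokes                         ≡⟨ cong length (LP.filter-all (incident? o) all-at-hub) ⟨
    deg o spokes                          ≤⟨ deg-++ˡ o spokes (tests ++ interior) ⟩
    deg o (spokes ++ tests ++ interior)   ≡⟨ cong (deg o) (LP.++-assoc spokes tests interior) ⟨
    deg o ((spokes ++ tests) ++ interior) ≡⟨ cong (λ es → deg o (es ++ interior)) probeEdges-split ⟨
    deg o (probeEdges n ++ interior)      ≡⟨ cong (deg o) graph-split ⟨
    deg o graph                           ∎)
    where
    open ℕP.≤-Reasoning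
    o : ℕ
    o = leftNumber {n} hub
    spokes tests interior : Graph
    spokes   = map (probeEdge ∘ inj₁) (L.allFin D)
    tests    = map (probeEdge ∘ inj₂) (L.allFin D)
    interior = map edge (map inj₂ (interiorNames n))
    all-at-hub : All (λ e → o ≡ proj₁ e ⊎ o ≡ proj₂ e) spokes
    all-at-hub = AllP.map⁺ (All.universal (λ _ → inj₁ refl) (L.allFin D))
    probeEdges-split : probeEdges n ≡ spokes ++ tests
    probeEdges-split = trans (LP.map-++ probeEdge (map inj₁ (L.allFin D)) _)
      (cong₂ _++_ (sym (LP.map-∘ (L.allFin D))) (sym (LP.map-∘ (L.allFin D))))

  graph-maxDegree : MaxDegree graph D
  graph-maxDegree = proper⇒deg≤ graph colouring-proper colouring-bounded , leftNumber {n} hub , deg-hub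

  graph-chromaticIndex : ChromaticIndex graph D
  graph-chromaticIndex = (colouring , colouring-proper , colouring-bounded)
    , λ k (cs , proper , bounded) → subst (_≤ k) deg-hub (proper⇒deg≤ graph proper bounded (leftNumber {n} hub))

  module Optimal (cs : List ℕ) (proper : ProperColoring graph cs) (uses-D : numColors cs ≡ D) where

    open NamedEdges (_≟ₑ_ {n})

    col : EdgeName n → ℕ
    col = colourOf (edgeNames n) cs

    col-proper : ∀ {κ κ'} → κ ≢ κ' → Adjacent (edge κ) (edge κ') → col κ ≢ col κ'
    col-proper = colourOf-proper edge (edgeNames n) proper (∈-edgeNames {n} _) (∈-edgeNames {n} _)

    col∈distinct : ∀ κ → col κ ∈ L.deduplicate ℕ._≟_ cs
    col∈distinct κ = ∈P.∈-deduplicate⁺ ℕ._≟_ (colourOf-∈ edge (edgeNames n) cs (∈-edgeNames κ) (proj₁ proper))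

    -- Exactly D colours occur, so a colour is determined by its position among them.
    colourIndex : EdgeName n → Fin D
    colourIndex κ = F.cast uses-D (Any.index (col∈distinct κ))

    colourIndex⇒col≡ : ∀ κ κ' → colourIndex κ ≡ colourIndex κ' → col κ ≡ col κ'
    colourIndex⇒col≡ κ κ' eq = begin
      col κ                                          ≡⟨ AnyP.lookup-index (col∈distinct κ) ⟩
      L.lookup distinct (Any.index (col∈distinct κ))  ≡⟨ cong (L.lookup distinct) same-index ⟩
      L.lookup distinct (Any.index (col∈distinct κ')) ≡⟨ AnyP.lookup-index (col∈distinct κ') ⟨
      col κ'                                         ∎
      where
      open ≡-Reasoning
      distinct : List ℕ
      distinct = L.deduplicate ℕ._≟_ cs
      same-index : Any.index (col∈distinct κ) ≡ Any.index (col∈distinct κ')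
      same-index = FP.toℕ-injective (trans (sym (FP.toℕ-cast uses-D _)) (trans (cong toℕ eq) (FP.toℕ-cast uses-D _)))

    colourIndex-injective-along : (g : Fin D → EdgeName n) → Injective _≡_ _≡_ g →
      (∀ s t → Adjacent (edge (g s)) (edge (g t))) → Injective _≡_ _≡_ (colourIndex ∘ g)
    colourIndex-injective-along g g-inj adj {s} {t} eq =
      decidable-stable (s F.≟ t) λ s≢t → col-proper (s≢t ∘ g-inj) (adj s t) (colourIndex⇒col≡ (g s) (g t) eq)

    -- Rows: xᵢ, then aᵢᵣ; columns: anchor i, then bᵢₛ. The missing corner xᵢ–anchor i is
    -- replaced by test i in row 0 and by anchorEdge i in column 0.
    module Gadget (i : Fin D) where

      rowEdge columnEdge : Fin D → Fin D → EdgeName n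
      rowEdge F.zero    F.zero    = test i
      rowEdge F.zero    (F.suc s) = top i s
      rowEdge (F.suc r) s         = cell i r s
      columnEdge F.zero    F.zero    = anchorEdge i
      columnEdge F.zero    (F.suc r) = cell i r F.zero
      columnEdge (F.suc s) F.zero    = top i s
      columnEdge (F.suc s) (F.suc r) = cell i r (F.suc s)

      rowEdge-injective : ∀ r → Injective _≡_ _≡_ (rowEdge r)
      rowEdge-injective F.zero    {F.zero}  {F.zero}  _    = refl
      rowEdge-injective F.zero    {F.suc _} {F.suc _} refl = refl
      rowEdge-injective (F.suc r) refl = refl

      columnEdge-injective : ∀ s → Injective _≡_ _≡_ (columnEdge s)
      columnEdge-injective F.zero    {F.zero}  {F.zero}  _    = refl
      columnEdge-injective F.zero    {F.suc _} {F.suc _} refl = refl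
      columnEdge-injective (F.suc s) {F.zero}  {F.zero}  _    = refl
      columnEdge-injective (F.suc s) {F.suc _} {F.suc _} refl = refl

      row-shares-left : ∀ r s t → left (rowEdge r s) ≡ left (rowEdge r t)
      row-shares-left F.zero    F.zero    F.zero    = refl
      row-shares-left F.zero    F.zero    (F.suc _) = refl
      row-shares-left F.zero    (F.suc _) F.zero    = refl
      row-shares-left F.zero    (F.suc _) (F.suc _) = refl
      row-shares-left (F.suc r) s         t         = refl

      column-shares-right : ∀ s r t → right (columnEdge s r) ≡ right (columnEdge s t)
      column-shares-right F.zero    F.zero    F.zero    = refl
      column-shares-right F.zero    F.zero    (F.suc _) = right-anchorEdge i
      column-shares-right F.zero    (F.suc _) F.zero    = sym (right-anchorEdge i)
      column-shares-right F.zero    (F.suc _) (F.suc _) = refl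
      column-shares-right (F.suc s) F.zero    F.zero    = refl
      column-shares-right (F.suc s) F.zero    (F.suc _) = refl
      column-shares-right (F.suc s) (F.suc _) F.zero    = refl
      column-shares-right (F.suc s) (F.suc _) (F.suc _) = refl

      open PuncturedSquare (λ r s → colourIndex (rowEdge r s)) (colourIndex (test i)) (colourIndex (anchorEdge i))

      row≗ : ∀ r → row r ≗ colourIndex ∘ rowEdge r
      row≗ F.zero    F.zero    = refl
      row≗ F.zero    (F.suc _) = refl
      row≗ (F.suc r) _         = refl

      column≗ : ∀ s → column s ≗ colourIndex ∘ columnEdge s
      column≗ F.zero    F.zero    = refl
      column≗ F.zero    (F.suc _) = refl
      column≗ (F.suc s) F.zero    = refl
      column≗ (F.suc s) (F.suc _) = refl

      test≡anchorEdge : col (test i) ≡ col (anchorEdge i)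
      test≡anchorEdge = colourIndex⇒col≡ (test i) (anchorEdge i) (pendants-agree
        (λ r → injective-resp-≗ (row≗ r) (colourIndex-injective-along (rowEdge r) (rowEdge-injective r)
                 λ s t → inj₁ (cong leftNumber (row-shares-left r s t))))
        (λ s → injective-resp-≗ (column≗ s) (colourIndex-injective-along (columnEdge s) (columnEdge-injective s)
                 λ r t → inj₂ (inj₂ (inj₂ (cong rightNumber (column-shares-right s r t)))))))

    test≡spoke : ∀ i → col (test i) ≡ col (spoke (f i))
    test≡spoke i = along-anchors i (FI.<-wellFounded i)
      where
      along-anchors : ∀ i → Acc F._<_ i → col (test i) ≡ col (spoke (f i))
      along-anchors i (acc earlier) with previous i in eqₚ
      ... | nothing = trans (Gadget.test≡anchorEdge i) (cong (col ∘ inj₁ ∘ anchorProbeVia i) eqₚ)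
      ... | just k  with previous-just i eqₚ
      ...   | fk≡fi , k<i = begin
        col (test i)          ≡⟨ Gadget.test≡anchorEdge i ⟩
        col (anchorEdge i)    ≡⟨ cong (col ∘ inj₁ ∘ anchorProbeVia i) eqₚ ⟩
        col (test k)          ≡⟨ along-anchors k (earlier k<i) ⟩
        col (spoke (f k))     ≡⟨ cong (col ∘ spoke) fk≡fi ⟩
        col (spoke (f i))     ∎
        where open ≡-Reasoning

    spoke-colours-distinct : ∀ {j j'} → j ≢ j' → col (spoke j) ≢ col (spoke j')
    spoke-colours-distinct j≢j' = col-proper (j≢j' ∘ Sum.inj₁-injective ∘ Sum.inj₁-injective) (inj₁ refl)

-- Reading f back from the advice

module Reconstruction {b} (n : ℕ) (A : OnlineAlg b) (solves : SolvesBipartite (suc n) A) where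

  open NamedEdges (_≟ₑ_ {n})

  D P : ℕ
  D = suc n
  P = length (probeEdges n)

  module G (f : Fin D → Fin D) = LowerBoundGraph n f

  solution : ∀ f → ∃[ as ] (length as ≡ length (G.graph f) × Optimal (G.graph f) (run A (G.graph f) as))
  solution f = solves (G.graph f) (G.graph-simple f) (G.graph-bipartite f) (G.graph-maxDegree f)

  advice : (Fin D → Fin D) → List (Advice b)
  advice f = proj₁ (solution f)

  colours : (Fin D → Fin D) → List ℕ
  colours f = run A (G.graph f) (advice f)

  module O (f : Fin D → Fin D) = G.Optimal f (colours f) (proj₁ (proj₂ (proj₂ (solution f))))
                                   (proj₂ (proj₂ (proj₂ (solution f))) D (G.graph-chromaticIndex f))

  P≤length-advice : ∀ f → P ≤ length (advice f)
  P≤length-advice f = begin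
    P                                         ≤⟨ ℕP.m≤m+n P _ ⟩
    P + length (map (G.edge f) (map inj₂ (interiorNames n))) ≡⟨ LP.length-++ (probeEdges n) ⟨
    length (probeEdges n ++ _)                ≡⟨ cong length (G.graph-split f) ⟨
    length (G.graph f)                        ≡⟨ proj₁ (proj₂ (solution f)) ⟨
    length (advice f)                         ∎
    where open ℕP.≤-Reasoning

  probeColour : List ℕ → ProbeName n → ℕ
  probeColour cs π = colourOf (map inj₁ (probeNames n)) cs (inj₁ π)

  probe-col : ∀ f π → O.col f (inj₁ π) ≡ probeColour (run A (probeEdges n) (take P (advice f))) π
  probe-col f π = begin
    O.col f (inj₁ π)                                          ≡⟨ colourOf-++ˡ (map inj₁ (probeNames n)) _ (colours f) probe∈ ⟩
    probeColour (take (length (map inj₁ (probeNames n))) (colours f)) π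
                                                              ≡⟨ cong (λ m → probeColour (take m (colours f)) π) same-length ⟩
    probeColour (take P (run A (G.graph f) (advice f))) π      ≡⟨ cong (λ es → probeColour (take P (run A es (advice f))) π) (G.graph-split f) ⟩
    probeColour (take P (run A (probeEdges n ++ _) (advice f))) π
                                                              ≡⟨ cong (λ cs → probeColour cs π) (runFrom-++-prefix A [] [] (probeEdges n) _ (advice f)) ⟩
    probeColour (run A (probeEdges n) (take P (advice f))) π   ∎
    where
    open ≡-Reasoning
    probe∈ : inj₁ π ∈ map inj₁ (probeNames n)
    probe∈ = ∈P.∈-map⁺ inj₁ (⊎ˡ-complete ∈P.∈-allFin ∈P.∈-allFin π)
    same-length : length (map inj₁ (probeNames n)) ≡ P
    same-length = trans (LP.length-map inj₁ (probeNames n)) (sym (LP.length-map probeEdge (probeNames n)))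

  probeAdvice-determines : ∀ f g → take P (advice f) ≡ take P (advice g) → f ≗ g
  probeAdvice-determines f g same i = decidable-stable (f i FP.≟ g i) λ fi≢gi →
    O.spoke-colours-distinct g fi≢gi (begin
      O.col g (spoke (f i)) ≡⟨ same-probe-col (inj₁ (f i)) ⟨
      O.col f (spoke (f i)) ≡⟨ O.test≡spoke f i ⟨
      O.col f (test i)      ≡⟨ same-probe-col (inj₂ i) ⟩
      O.col g (test i)      ≡⟨ O.test≡spoke g i ⟩
      O.col g (spoke (g i)) ∎)
    where
    open ≡-Reasoning
    same-probe-col : ∀ π → O.col f (inj₁ π) ≡ O.col g (inj₁ π)
    same-probe-col π = begin
      O.col f (inj₁ π)                                       ≡⟨ probe-col f π ⟩
      probeColour (run A (probeEdges n) (take P (advice f))) π ≡⟨ cong (λ as → probeColour (run A (probeEdges n) as) π) same ⟩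
      probeColour (run A (probeEdges n) (take P (advice g))) π ≡⟨ probe-col g π ⟨
      O.col g (inj₁ π)                                       ∎

  encodeAdvice : Fin (D ^ D) → Fin ((2 ^ b) ^ P)
  encodeAdvice k = encodeList (V.replicate b false) encodeBits P (take P (advice (finToFun k)))

  encodeAdvice-injective : Injective _≡_ _≡_ encodeAdvice
  encodeAdvice-injective {k} {k'} eq = finToFun-injective (probeAdvice-determines (finToFun k) (finToFun k')
    (encodeList-injective (V.replicate b false) encodeBits-injective P (length-prefix k) (length-prefix k') eq))
    where
    length-prefix : ∀ k → length (take P (advice (finToFun k))) ≡ P
    length-prefix k = trans (LP.length-take P (advice (finToFun k))) (ℕP.m≤n⇒m⊓n≡m (P≤length-advice (finToFun k)))

theorem5 : ∃[ k ] ((Δ b : ℕ) → 2 ≤ Δ → (A : OnlineAlg b) → SolvesBipartite Δ A → ⌊log₂ Δ ⌋ ≤ k * b)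
theorem5 = 2 , bound
  where
  bound : (Δ b : ℕ) → 2 ≤ Δ → (A : OnlineAlg b) → SolvesBipartite Δ A → ⌊log₂ Δ ⌋ ≤ 2 * b
  -- The argument needs only Δ ≠ 0.
  bound (suc n) b _ A solves = ⌊log₂⌋-bound (suc n) b
    (subst (λ P → suc n ^ suc n ≤ (2 ^ b) ^ P) probes
      (FP.injective⇒≤ (Reconstruction.encodeAdvice-injective n A solves)))
    where
    probes : length (probeEdges n) ≡ 2 * suc n
    probes = trans (LP.length-map probeEdge (probeNames n)) (length-probeNames n)
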